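{- Let $D=(d_1,\ldots,d_n)$, with $d_1\ge d_2\ge\cdots\ge d_n$, be a forcibly bicyclic graphic sequence. If $n\ge 7$, then $d_4=2$.
   Context: All graphs are simple. A realization of a sequence $D=(d_1,\ldots,d_n)$ is a simple graph with vertices $v_1,\ldots,v_n$ with $\deg(v_i)=d_i$; $D$ is graphic if it has a realization. A graphic sequence is forcibly bicyclic if every realization of it is connected and has exactly $n+1$ edges. -}

module Defs where

open import Data.Nat using (ℕ; zero; suc; _+_; _≤_; _<_)
open import Data.Fin using (Fin; toℕ)
open import Data.Bool using (Bool; true; false; if_then_else_)
open import Data.List using (List; map; allFin)
open import Data.Nat.ListAction using (sum)
open import Data.Product using (Σ; ∃; _×_; _,_)
open import Relation.Binary.PropositionalEquality using (_≡_)

record Graph (n : ℕ) : Set where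
  field
    adj    : Fin n → Fin n → Bool
    sym    : ∀ i j → adj i j ≡ adj j i
    irrefl : ∀ i → adj i i ≡ false
open Graph public

𝟙 : Bool → ℕ
𝟙 b = if b then 1 else 0

deg : ∀ {n} → Graph n → Fin n → ℕ
deg {n} G i = sum (map (λ j → 𝟙 (adj G i j)) (allFin n))

edges : ∀ {n} → Graph n → ℕ
edges {n} G =
  sum (map (λ i → sum (map (λ j → if Data.Nat._<ᵇ_ (toℕ i) (toℕ j) then 𝟙 (adj G i j) else 0)
                           (allFin n)))
           (allFin n))

data Reachable {n : ℕ} (G : Graph n) : Fin n → Fin n → Set where
  here : ∀ {i} → Reachable G i i
  step : ∀ {i k j} → adj G i k ≡ true → Reachable G k j → Reachable G i j

Connected : ∀ {n} → Graph n → Set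
Connected {n} G = ∀ (i j : Fin n) → Reachable G i j

Realizes : ∀ {n} → Graph n → (Fin n → ℕ) → Set
Realizes {n} G D = ∀ (i : Fin n) → deg G i ≡ D i

Graphic : ∀ {n} → (Fin n → ℕ) → Set
Graphic {n} D = Σ (Graph n) (λ G → Realizes G D)

ForciblyBicyclic : ∀ {n} → (Fin n → ℕ) → Set
ForciblyBicyclic {n} D =
  Graphic D × (∀ (G : Graph n) → Realizes G D → Connected G × edges G ≡ n + 1)

NonIncreasing : ∀ {n} → (Fin n → ℕ) → Set
NonIncreasing {n} D = ∀ (i j : Fin n) → toℕ i ≤ toℕ j → D j ≤ D i

-- If d₄ ≤ 1, all vertices but the first three are leaves. In a connected graph
-- with at least three vertices no two leaves are adjacent, so each of the three
-- hubs has at most two hub neighbours and the degree sum is at most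
-- 6 + 2(n − 3) = 2n, short of the 2(n + 1) forced by n + 1 edges.
-- If d₄ ≥ 3, let the c ≥ 4 entries that are at least 2 be d_v = 2 + [v < 4] + q_v;
-- the degree sum 2(n + 1) forces n = c + Σ q_v + 2. Then D has a disconnected
-- realization: a cycle on the c hubs with chords 0–2 and 1–3, q_v pendant
-- vertices at each hub v, and a separate edge on the two remaining vertices.

module Submission where

open import Defs
open import Data.Nat using (ℕ; _+_)
open import Data.Fin using (Fin; suc; zero)
open import Relation.Binary.PropositionalEquality using (_≡_)

open import Data.Bool using (Bool; true; false; T; if_then_else_; _∧_; _∨_)
open import Data.Bool.Properties using (T-≡; T-∧; T-∨; ∧-comm; ∨-comm; ∨-zeroʳ)
open import Data.Empty using (⊥; ⊥-elim)
open import Data.Fin using (toℕ; fromℕ<; _↑ˡ_; _↑ʳ_; punchIn; punchOut)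
open import Data.Fin.Properties using (toℕ-injective; toℕ<n; toℕ-fromℕ<; fromℕ<-toℕ)
open import Data.List using (map; tabulate)
open import Data.Nat using (zero; suc; _*_; _∸_; _≤_; _<_; _<ᵇ_; _≡ᵇ_; z≤n; s≤s)
open import Data.Nat.ListAction as List using ()
open import Data.Nat.Properties
open import Data.Nat.Tactic.RingSolver using (solve-∀)
open import Algebra.Properties.Semiring.Sum +-*-semiring
  using (sum; sum-syntax; sum-cong-≗; ∑-distrib-+; ∑-comm; sum-remove; *-distribˡ-sum)
open import Data.Product using (Σ-syntax; _×_; _,_; proj₁; proj₂)
open import Data.Sum using (_⊎_; inj₁; inj₂)
open import Data.Vec.Functional.Properties using (removeAt-punchOut)
open import Function using (_∘_; case_of_)
open import Function.Bundles using (Equivalence)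
open import Relation.Binary using (tri<; tri≈; tri>)
open import Relation.Binary.Construct.Union using (_∪_)
open import Relation.Binary.PropositionalEquality as ≡
  using (refl; trans; cong; cong₂; subst; subst₂; _≢_; module ≡-Reasoning)
open import Relation.Nullary using (¬_; yes; no; Dec)

∑-const : ∀ n x → ∑[ i < n ] x ≡ n * x
∑-const zero    x = refl
∑-const (suc n) x = cong (x +_) (∑-const n x)

∑-mono-≤ : ∀ {n} {t u : Fin n → ℕ} → (∀ i → t i ≤ u i) → sum t ≤ sum u
∑-mono-≤ {zero}  t≤u = z≤n
∑-mono-≤ {suc n} t≤u = +-mono-≤ (t≤u zero) (∑-mono-≤ (t≤u ∘ suc))

∑-split : ∀ s {k} (t : Fin (s + k) → ℕ) →
          sum t ≡ ∑[ i < s ] t (i ↑ˡ k) + ∑[ l < k ] t (s ↑ʳ l)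
∑-split zero    t = refl
∑-split (suc s) {k} t = trans (cong (t zero +_) (∑-split s (t ∘ suc)))
  (≡.sym (+-assoc (t zero) (∑[ i < s ] t (suc i ↑ˡ k)) (∑[ l < k ] t (suc s ↑ʳ l))))

term≤∑ : ∀ {n} (t : Fin n → ℕ) i → t i ≤ sum t
term≤∑ t zero    = m≤m+n (t zero) _
term≤∑ t (suc i) = ≤-trans (term≤∑ (t ∘ suc) i) (m≤n+m _ (t zero))

pair≤∑ : ∀ {n} (t : Fin (suc n) → ℕ) {i j} → i ≢ j → t i + t j ≤ sum t
pair≤∑ t {i} {j} i≢j = subst (t i + t j ≤_) (≡.sym (sum-remove t))
  (+-monoʳ-≤ (t i) (subst (_≤ sum (t ∘ punchIn i)) (removeAt-punchOut t i≢j)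
                          (term≤∑ (t ∘ punchIn i) (punchOut i≢j))))

∑-indicator-≤ : ∀ {n} (t : Fin n → ℕ) i → t i ≡ 0 → (∀ j → t j ≤ 1) → sum t ≤ n ∸ 1
∑-indicator-≤ {suc n} t i tᵢ≡0 t≤1 = begin
  sum t                             ≡⟨ sum-remove t ⟩
  t i + ∑[ j < n ] t (punchIn i j)  ≡⟨ cong (_+ ∑[ j < n ] t (punchIn i j)) tᵢ≡0 ⟩
  ∑[ j < n ] t (punchIn i j)        ≤⟨ ∑-mono-≤ (t≤1 ∘ punchIn i) ⟩
  ∑[ j < n ] 1                      ≡⟨ trans (∑-const n 1) (*-identityʳ n) ⟩
  n                                 ∎
  where open ≤-Reasoning

sum-map-tabulate : ∀ {A : Set} {n} (g : Fin n → A) (f : A → ℕ) →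
                   List.sum (map f (tabulate g)) ≡ ∑[ j < n ] f (g j)
sum-map-tabulate {n = zero}  g f = refl
sum-map-tabulate {n = suc n} g f = cong (f (g zero) +_) (sum-map-tabulate (g ∘ suc) f)

deg-∑ : ∀ {n} (G : Graph n) i → deg G i ≡ ∑[ j < n ] 𝟙 (adj G i j)
deg-∑ G i = sum-map-tabulate (λ j → j) (λ j → 𝟙 (adj G i j))

upperAdj : ∀ {n} → Graph n → Fin n → Fin n → ℕ
upperAdj G i j = if toℕ i <ᵇ toℕ j then 𝟙 (adj G i j) else 0

edges-∑ : ∀ {n} (G : Graph n) → edges G ≡ ∑[ i < n ] ∑[ j < n ] upperAdj G i j
edges-∑ {n} G =
  trans (sum-map-tabulate (λ i → i) (λ i → List.sum (map (upperAdj G i) (tabulate (λ j → j)))))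
        (sum-cong-≗ (λ i → sum-map-tabulate (λ j → j) (upperAdj G i)))

<ᵇ-false : ∀ {m n} → n ≤ m → (m <ᵇ n) ≡ false
<ᵇ-false {m} {n} n≤m with m <ᵇ n in eq
... | false = refl
... | true  = ⊥-elim (<⇒≱ (<ᵇ⇒< m n (subst T (≡.sym eq) _)) n≤m)

<ᵇ-true : ∀ {m n} → m < n → (m <ᵇ n) ≡ true
<ᵇ-true {m} {n} m<n with m <ᵇ n in eq
... | true  = refl
... | false = ⊥-elim (subst T eq (<⇒<ᵇ m<n))

adj-upper : ∀ {n} (G : Graph n) i j → 𝟙 (adj G i j) ≡ upperAdj G i j + upperAdj G j i
adj-upper G i j with <-cmp (toℕ i) (toℕ j)
... | tri< i<j _ _ rewrite <ᵇ-false {toℕ j} (<⇒≤ i<j) | <ᵇ-true i<j = ≡.sym (+-identityʳ _)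
... | tri> _ _ j<i rewrite <ᵇ-false {toℕ i} (<⇒≤ j<i) | <ᵇ-true j<i = cong 𝟙 (Graph.sym G i j)
... | tri≈ _ i≡j _ rewrite toℕ-injective i≡j | Graph.irrefl G j | <ᵇ-false {toℕ j} (≤-refl {toℕ j})
  = refl

handshake : ∀ {n} (G : Graph n) → sum (deg G) ≡ edges G + edges G
handshake {n} G = begin
  ∑[ i < n ] deg G i
    ≡⟨ sum-cong-≗ (deg-∑ G) ⟩
  ∑[ i < n ] ∑[ j < n ] 𝟙 (adj G i j)
    ≡⟨ sum-cong-≗ (λ i → sum-cong-≗ (adj-upper G i)) ⟩
  ∑[ i < n ] ∑[ j < n ] (upperAdj G i j + upperAdj G j i)
    ≡⟨ sum-cong-≗ (λ i → ∑-distrib-+ (upperAdj G i) (λ j → upperAdj G j i)) ⟩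
  ∑[ i < n ] (∑[ j < n ] upperAdj G i j + ∑[ j < n ] upperAdj G j i)
    ≡⟨ ∑-distrib-+ (λ i → ∑[ j < n ] upperAdj G i j) (λ i → ∑[ j < n ] upperAdj G j i) ⟩
  ∑[ i < n ] ∑[ j < n ] upperAdj G i j + ∑[ i < n ] ∑[ j < n ] upperAdj G j i
    ≡⟨ cong (∑[ i < n ] ∑[ j < n ] upperAdj G i j +_) (∑-comm (λ i j → upperAdj G j i)) ⟩
  ∑[ i < n ] ∑[ j < n ] upperAdj G i j + ∑[ i < n ] ∑[ j < n ] upperAdj G i j
    ≡⟨ ≡.sym (cong₂ _+_ (edges-∑ G) (edges-∑ G)) ⟩
  edges G + edges G ∎
  where open ≡-Reasoning

adj⇒0<deg : ∀ {n} (G : Graph n) {i j} → adj G i j ≡ true → 0 < deg G i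
adj⇒0<deg G {i} {j} i~j = subst (0 <_) (≡.sym (deg-∑ G i))
  (≤-trans (subst (λ b → 1 ≤ 𝟙 b) (≡.sym i~j) ≤-refl) (term≤∑ (λ k → 𝟙 (adj G i k)) j))

deg≡0⇒¬adj : ∀ {n} (G : Graph n) {i j} → deg G j ≡ 0 → adj G i j ≡ false
deg≡0⇒¬adj G {i} {j} dⱼ≡0 with adj G i j in i~j
... | false = refl
... | true  = ⊥-elim (<-irrefl (≡.sym dⱼ≡0) (adj⇒0<deg G (trans (Graph.sym G j i) i~j)))

reachable⇒0<deg : ∀ {n} (G : Graph n) {i j} → Reachable G i j → i ≢ j → 0 < deg G i
reachable⇒0<deg G here         i≢i = ⊥-elim (i≢i refl)
reachable⇒0<deg G (step i~k _) _   = adj⇒0<deg G i~k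

connected⇒0<deg : ∀ {n} (G : Graph (suc (suc n))) → Connected G → ∀ i → 0 < deg G i
connected⇒0<deg G conn zero    = reachable⇒0<deg G (conn zero (suc zero)) λ ()
connected⇒0<deg G conn (suc i) = reachable⇒0<deg G (conn (suc i) zero) λ ()

leaf-neighbour-unique : ∀ {n} (G : Graph n) {i j k} →
                        deg G i ≡ 1 → adj G i j ≡ true → adj G i k ≡ true → j ≡ k
leaf-neighbour-unique {suc n} G {i} {j} {k} dᵢ≡1 i~j i~k with j Data.Fin.≟ k
... | yes j≡k = j≡k
... | no  j≢k = ⊥-elim (1+n≰n (begin
  2                                 ≡⟨ cong₂ (λ b c → 𝟙 b + 𝟙 c) i~j i~k ⟨
  𝟙 (adj G i j) + 𝟙 (adj G i k)     ≤⟨ pair≤∑ (λ l → 𝟙 (adj G i l)) j≢k ⟩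
  ∑[ l < suc n ] 𝟙 (adj G i l)      ≡⟨ deg-∑ G i ⟨
  deg G i                           ≡⟨ dᵢ≡1 ⟩
  1                                 ∎))
  where open ≤-Reasoning

leafEdge-closed : ∀ {n} (G : Graph n) {u v x w} →
                  deg G u ≡ 1 → deg G v ≡ 1 → adj G u v ≡ true →
                  Reachable G x w → x ≡ u ⊎ x ≡ v → w ≡ u ⊎ w ≡ v
leafEdge-closed G du dv u~v here x∈uv = x∈uv
leafEdge-closed G du dv u~v (step x~y y⇝w) (inj₁ refl) =
  leafEdge-closed G du dv u~v y⇝w (inj₂ (leaf-neighbour-unique G du x~y u~v))
leafEdge-closed G {u} {v} du dv u~v (step x~y y⇝w) (inj₂ refl) =
  leafEdge-closed G du dv u~v y⇝w (inj₁ (leaf-neighbour-unique G dv x~y (trans (Graph.sym G v u) u~v)))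

leafEdge⇒¬connected : ∀ {n} (G : Graph n) {u v w} →
                      deg G u ≡ 1 → deg G v ≡ 1 → adj G u v ≡ true →
                      w ≢ u → w ≢ v → ¬ Connected G
leafEdge⇒¬connected G {u} {w = w} du dv u~v w≢u w≢v conn
  with leafEdge-closed G du dv u~v (conn u w) (inj₁ refl)
... | inj₁ w≡u = w≢u w≡u
... | inj₂ w≡v = w≢v w≡v

𝟙≤1 : ∀ b → 𝟙 b ≤ 1
𝟙≤1 true  = ≤-refl
𝟙≤1 false = z≤n

degreeSum-leaves : ∀ s {k} (G : Graph (s + k)) →
                   (∀ l → deg G (s ↑ʳ l) ≡ 1) →
                   (∀ l l′ → adj G (s ↑ʳ l) (s ↑ʳ l′) ≡ false) →
                   sum (deg G) ≤ s * (s ∸ 1) + (k + k)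
degreeSum-leaves s {k} G leaf leaves-apart = begin
  sum (deg G)
    ≡⟨ ∑-split s (deg G) ⟩
  ∑[ i < s ] deg G (hub i) + ∑[ l < k ] deg G (s ↑ʳ l)
    ≤⟨ +-mono-≤ (∑-mono-≤ hub-bound) (≤-reflexive (sum-cong-≗ leaf)) ⟩
  ∑[ i < s ] (s ∸ 1 + toLeaves i) + ∑[ l < k ] 1
    ≡⟨ cong₂ _+_ (∑-distrib-+ (λ _ → s ∸ 1) toLeaves) (trans (∑-const k 1) (*-identityʳ k)) ⟩
  ∑[ i < s ] (s ∸ 1) + ∑[ i < s ] toLeaves i + k
    ≡⟨ cong (λ x → x + k) (cong₂ _+_ (∑-const s (s ∸ 1)) hubs-to-leaves) ⟩
  s * (s ∸ 1) + k + k
    ≡⟨ +-assoc (s * (s ∸ 1)) k k ⟩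
  s * (s ∸ 1) + (k + k) ∎
  where
  open ≤-Reasoning
  a : Fin (s + k) → Fin (s + k) → ℕ
  a i j = 𝟙 (adj G i j)
  hub : Fin s → Fin (s + k)
  hub i = i ↑ˡ k
  toLeaves : Fin s → ℕ
  toLeaves i = ∑[ l < k ] a (hub i) (s ↑ʳ l)
  deg-split : ∀ v → deg G v ≡ ∑[ j < s ] a v (hub j) + ∑[ l < k ] a v (s ↑ʳ l)
  deg-split v = trans (deg-∑ G v) (∑-split s (a v))
  hub-bound : ∀ i → deg G (hub i) ≤ s ∸ 1 + toLeaves i
  hub-bound i = subst (_≤ s ∸ 1 + toLeaves i) (≡.sym (deg-split (hub i)))
    (+-monoˡ-≤ (toLeaves i)
      (∑-indicator-≤ (λ j → a (hub i) (hub j)) i (cong 𝟙 (Graph.irrefl G (hub i))) (λ j → 𝟙≤1 _)))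
  leaf-to-hubs : ∀ l → ∑[ i < s ] a (s ↑ʳ l) (hub i) ≡ 1
  leaf-to-hubs l = begin-equality
    ∑[ i < s ] a (s ↑ʳ l) (hub i)
      ≡⟨ +-identityʳ _ ⟨
    ∑[ i < s ] a (s ↑ʳ l) (hub i) + 0
      ≡⟨ cong (∑[ i < s ] a (s ↑ʳ l) (hub i) +_) no-leaf-neighbours ⟨
    ∑[ i < s ] a (s ↑ʳ l) (hub i) + ∑[ l′ < k ] a (s ↑ʳ l) (s ↑ʳ l′)
      ≡⟨ deg-split (s ↑ʳ l) ⟨
    deg G (s ↑ʳ l)
      ≡⟨ leaf l ⟩
    1 ∎
    where
    no-leaf-neighbours : ∑[ l′ < k ] a (s ↑ʳ l) (s ↑ʳ l′) ≡ 0
    no-leaf-neighbours = trans (sum-cong-≗ (λ l′ → cong 𝟙 (leaves-apart l l′)))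
                               (trans (∑-const k 0) (*-zeroʳ k))
  hubs-to-leaves : ∑[ i < s ] toLeaves i ≡ k
  hubs-to-leaves = begin-equality
    ∑[ i < s ] ∑[ l < k ] a (hub i) (s ↑ʳ l)
      ≡⟨ ∑-comm (λ i l → a (hub i) (s ↑ʳ l)) ⟩
    ∑[ l < k ] ∑[ i < s ] a (hub i) (s ↑ʳ l)
      ≡⟨ sum-cong-≗ (λ l → sum-cong-≗ (λ i → cong 𝟙 (Graph.sym G (hub i) (s ↑ʳ l)))) ⟩
    ∑[ l < k ] ∑[ i < s ] a (s ↑ʳ l) (hub i)
      ≡⟨ sum-cong-≗ leaf-to-hubs ⟩
    ∑[ l < k ] 1
      ≡⟨ trans (∑-const k 1) (*-identityʳ k) ⟩
    k ∎

edges≤-threeHubs : ∀ {k} (G : Graph (3 + k)) → Connected G →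
                  (∀ l → deg G (3 ↑ʳ l) ≡ 1) → edges G ≤ 3 + k
edges≤-threeHubs {k} G conn leaf = ≮⇒≥ λ 3+k<e → <⇒≱ (+-mono-< 3+k<e 3+k<e) (begin
  edges G + edges G   ≡⟨ handshake G ⟨
  sum (deg G)         ≤⟨ degreeSum-leaves 3 G leaf leaves-apart ⟩
  6 + (k + k)         ≡⟨ double k ⟩
  3 + k + (3 + k)     ∎)
  where
  open ≤-Reasoning
  double : ∀ k → 6 + (k + k) ≡ 3 + k + (3 + k)
  double = solve-∀
  leaves-apart : ∀ l l′ → adj G (3 ↑ʳ l) (3 ↑ʳ l′) ≡ false
  leaves-apart l l′ with adj G (3 ↑ʳ l) (3 ↑ʳ l′) in l~l′
  ... | false = refl
  ... | true  = ⊥-elim (leafEdge⇒¬connected G {w = zero} (leaf l) (leaf l′) l~l′ (λ ()) (λ ()) conn)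

sumBelow : ℕ → (ℕ → ℕ) → ℕ
sumBelow zero    f = 0
sumBelow (suc n) f = sumBelow n f + f n

sumBelow-suc : ∀ n f → sumBelow (suc n) f ≡ f 0 + sumBelow n (f ∘ suc)
sumBelow-suc zero    f = +-comm 0 (f 0)
sumBelow-suc (suc n) f = begin
  sumBelow (suc n) f + f (suc n)             ≡⟨ cong (_+ f (suc n)) (sumBelow-suc n f) ⟩
  f 0 + sumBelow n (f ∘ suc) + f (suc n)     ≡⟨ +-assoc (f 0) _ _ ⟩
  f 0 + sumBelow (suc n) (f ∘ suc)           ∎
  where open ≡-Reasoning

∑-toℕ : ∀ n f → ∑[ i < n ] f (toℕ i) ≡ sumBelow n f
∑-toℕ zero    f = refl
∑-toℕ (suc n) f = trans (cong (f 0 +_) (∑-toℕ n (f ∘ suc))) (≡.sym (sumBelow-suc n f))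

sumBelow-+ : ∀ a b f → sumBelow (a + b) f ≡ sumBelow a f + sumBelow b (λ k → f (a + k))
sumBelow-+ a zero    f = trans (cong (λ x → sumBelow x f) (+-identityʳ a)) (≡.sym (+-identityʳ _))
sumBelow-+ a (suc b) f = begin
  sumBelow (a + suc b) f                                   ≡⟨ cong (λ x → sumBelow x f) (+-suc a b) ⟩
  sumBelow (a + b) f + f (a + b)                           ≡⟨ cong (_+ f (a + b)) (sumBelow-+ a b f) ⟩
  sumBelow a f + sumBelow b (λ k → f (a + k)) + f (a + b)  ≡⟨ +-assoc (sumBelow a f) _ _ ⟩
  sumBelow a f + sumBelow (suc b) (λ k → f (a + k))        ∎
  where open ≡-Reasoning

sumBelow-cong : ∀ n {f g : ℕ → ℕ} → (∀ k → k < n → f k ≡ g k) → sumBelow n f ≡ sumBelow n g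
sumBelow-cong zero    _   = refl
sumBelow-cong (suc n) f≡g =
  cong₂ _+_ (sumBelow-cong n (λ k k<n → f≡g k (m<n⇒m<1+n k<n))) (f≡g n ≤-refl)

sumBelow-distrib-+ : ∀ n f g → sumBelow n (λ k → f k + g k) ≡ sumBelow n f + sumBelow n g
sumBelow-distrib-+ zero    f g = refl
sumBelow-distrib-+ (suc n) f g = trans (cong (_+ (f n + g n)) (sumBelow-distrib-+ n f g))
                                       (+-+-comm (sumBelow n f) (sumBelow n g) (f n) (g n))
  where
  +-+-comm : ∀ a b c d → a + b + (c + d) ≡ a + c + (b + d)
  +-+-comm = solve-∀

sumBelow-const : ∀ n x → sumBelow n (λ _ → x) ≡ n * x
sumBelow-const n x = trans (≡.sym (∑-toℕ n (λ _ → x))) (∑-const n x)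

sumBelow-mono : ∀ (f : ℕ → ℕ) {m n} → m ≤ n → sumBelow m f ≤ sumBelow n f
sumBelow-mono f {m} {n} m≤n = subst (sumBelow m f ≤_)
  (trans (≡.sym (sumBelow-+ m (n ∸ m) f)) (cong (λ x → sumBelow x f) (m+[n∸m]≡n m≤n)))
  (m≤m+n _ _)

δ : ℕ → ℕ → ℕ
δ v a = 𝟙 (v ≡ᵇ a)

δ-refl : ∀ v → δ v v ≡ 1
δ-refl v = cong 𝟙 (Equivalence.to T-≡ (≡⇒≡ᵇ v v refl))

δ-≢ : ∀ {v a} → v ≢ a → δ v a ≡ 0
δ-≢ {v} {a} v≢a with v ≡ᵇ a in eq
... | false = refl
... | true  = ⊥-elim (v≢a (≡ᵇ⇒≡ v a (Equivalence.from T-≡ eq)))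

sumBelow-δ-outside : ∀ (g : ℕ → ℕ) {x v} → x ≤ v → sumBelow x (λ y → g y * δ v y) ≡ 0
sumBelow-δ-outside g {zero}  x≤v = refl
sumBelow-δ-outside g {suc x} x<v = cong₂ _+_ (sumBelow-δ-outside g (<⇒≤ x<v))
  (trans (cong (g x *_) (δ-≢ (>⇒≢ x<v))) (*-zeroʳ (g x)))

sumBelow-δ-inside : ∀ (g : ℕ → ℕ) {x v} → v < x → sumBelow x (λ y → g y * δ v y) ≡ g v
sumBelow-δ-inside g {suc x} {v} v<1+x with m≤n⇒m<n∨m≡n (≤-pred v<1+x)
... | inj₁ v<x  = trans (cong₂ _+_ (sumBelow-δ-inside g v<x) (cong (g x *_) (δ-≢ (<⇒≢ v<x))))
                        (trans (cong (g v +_) (*-zeroʳ (g x))) (+-identityʳ (g v)))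
... | inj₂ refl = trans (cong₂ _+_ (sumBelow-δ-outside g {v} ≤-refl) (cong (g v *_) (δ-refl v)))
                        (*-identityʳ (g v))

interval : ℕ → ℕ → ℕ → ℕ
interval ℓ k v = sumBelow k (λ i → δ v (ℓ + i))

interval-outside : ∀ ℓ k {v} → v < ℓ ⊎ ℓ + k ≤ v → interval ℓ k v ≡ 0
interval-outside ℓ k {v} v∉ = trans (sumBelow-cong k off) (trans (sumBelow-const k 0) (*-zeroʳ k))
  where
  off : ∀ i → i < k → δ v (ℓ + i) ≡ 0
  off i i<k = δ-≢ (case v∉ of λ where
    (inj₁ v<ℓ)   → <⇒≢ (≤-trans v<ℓ (m≤m+n ℓ i))
    (inj₂ ℓ+k≤v) → >⇒≢ (<-≤-trans (+-monoʳ-< ℓ i<k) ℓ+k≤v))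

interval-inside : ∀ ℓ k {v} → ℓ ≤ v → v < ℓ + k → interval ℓ k v ≡ 1
interval-inside ℓ zero {v} ℓ≤v v<ℓ+0 = ⊥-elim (<⇒≱ v<ℓ+0 (subst (_≤ v) (≡.sym (+-identityʳ ℓ)) ℓ≤v))
interval-inside ℓ (suc k) {v} ℓ≤v v<ℓ+1+k
  with m≤n⇒m<n∨m≡n (≤-pred (subst (v <_) (+-suc ℓ k) v<ℓ+1+k))
... | inj₁ v<ℓ+k =
  trans (cong₂ _+_ (interval-inside ℓ k ℓ≤v v<ℓ+k) (δ-≢ (<⇒≢ v<ℓ+k))) (+-identityʳ 1)
... | inj₂ refl  = cong₂ _+_ (interval-outside ℓ k (inj₂ ≤-refl)) (δ-refl (ℓ + k))

interval-+ : ∀ ℓ a b v → interval ℓ (a + b) v ≡ interval ℓ a v + interval (ℓ + a) b v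
interval-+ ℓ a b v = trans (sumBelow-+ a b (λ i → δ v (ℓ + i)))
  (cong (interval ℓ a v +_) (sumBelow-cong b (λ k _ → cong (δ v) (≡.sym (+-assoc ℓ a k)))))

-- Endpoints are named by their numeric labels (toℕ), since the construction
-- below places vertices by arithmetic on those labels.
Pair : ℕ → ℕ → ℕ → ℕ → Set
Pair a b x y = (x ≡ a × y ≡ b) ⊎ (x ≡ b × y ≡ a)

isEdge : ℕ → ℕ → ℕ → ℕ → Bool
isEdge a b x y = ((x ≡ᵇ a) ∧ (y ≡ᵇ b)) ∨ ((x ≡ᵇ b) ∧ (y ≡ᵇ a))

isEdge⇒Pair : ∀ a b x y → isEdge a b x y ≡ true → Pair a b x y
isEdge⇒Pair a b x y e with Equivalence.to T-∨ (Equivalence.from T-≡ e)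
... | inj₁ t = let x≡a , y≡b = Equivalence.to T-∧ t in inj₁ (≡ᵇ⇒≡ x a x≡a , ≡ᵇ⇒≡ y b y≡b)
... | inj₂ t = let x≡b , y≡a = Equivalence.to T-∧ t in inj₂ (≡ᵇ⇒≡ x b x≡b , ≡ᵇ⇒≡ y a y≡a)

isEdge-sym : ∀ a b x y → isEdge a b x y ≡ isEdge a b y x
isEdge-sym a b x y = trans (cong₂ _∨_ (∧-comm (x ≡ᵇ a) (y ≡ᵇ b)) (∧-comm (x ≡ᵇ b) (y ≡ᵇ a)))
                           (∨-comm ((y ≡ᵇ b) ∧ (x ≡ᵇ a)) ((y ≡ᵇ a) ∧ (x ≡ᵇ b)))

isEdge-irrefl : ∀ {a b} → a ≢ b → ∀ x → isEdge a b x x ≡ false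
isEdge-irrefl {a} {b} a≢b x with isEdge a b x x in e
... | false = refl
... | true with isEdge⇒Pair a b x x e
...   | inj₁ (refl , x≡b) = ⊥-elim (a≢b x≡b)
...   | inj₂ (refl , x≡a) = ⊥-elim (a≢b (≡.sym x≡a))

𝟙-∧ : ∀ p q → 𝟙 (p ∧ q) ≡ 𝟙 p * 𝟙 q
𝟙-∧ true  q = ≡.sym (+-identityʳ (𝟙 q))
𝟙-∧ false q = refl

𝟙-∨ : ∀ p q → (p ≡ true → q ≡ true → ⊥) → 𝟙 (p ∨ q) ≡ 𝟙 p + 𝟙 q
𝟙-∨ true  true  both = ⊥-elim (both refl refl)
𝟙-∨ true  false _    = refl
𝟙-∨ false q     _    = refl

∑-δ : ∀ {n} b → b < n → ∑[ j < n ] δ (toℕ j) b ≡ 1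
∑-δ {suc n} zero    _         = cong suc (trans (∑-const n 0) (*-zeroʳ n))
∑-δ {suc n} (suc b) (s≤s b<n) = ∑-δ b b<n

𝟙-isEdge : ∀ {a b} → a ≢ b → ∀ x y → 𝟙 (isEdge a b x y) ≡ δ x a * δ y b + δ x b * δ y a
𝟙-isEdge {a} {b} a≢b x y =
  trans (𝟙-∨ ((x ≡ᵇ a) ∧ (y ≡ᵇ b)) ((x ≡ᵇ b) ∧ (y ≡ᵇ a)) not-both)
        (cong₂ _+_ (𝟙-∧ (x ≡ᵇ a) (y ≡ᵇ b)) (𝟙-∧ (x ≡ᵇ b) (y ≡ᵇ a)))
  where
  first : ∀ c d → ((x ≡ᵇ c) ∧ (y ≡ᵇ d)) ≡ true → x ≡ c
  first c d e = ≡ᵇ⇒≡ x c (proj₁ (Equivalence.to T-∧ (Equivalence.from T-≡ e)))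
  not-both : ((x ≡ᵇ a) ∧ (y ≡ᵇ b)) ≡ true → ((x ≡ᵇ b) ∧ (y ≡ᵇ a)) ≡ true → ⊥
  not-both p q = a≢b (trans (≡.sym (first a b p)) (first b a q))

∑-isEdge : ∀ {n a b} → a ≢ b → a < n → b < n →
           ∀ x → ∑[ j < n ] 𝟙 (isEdge a b x (toℕ j)) ≡ δ x a + δ x b
∑-isEdge {n} {a} {b} a≢b a<n b<n x = begin
  ∑[ j < n ] 𝟙 (isEdge a b x (toℕ j))
    ≡⟨ sum-cong-≗ {n} (λ j → 𝟙-isEdge a≢b x (toℕ j)) ⟩
  ∑[ j < n ] (δ x a * δ (toℕ j) b + δ x b * δ (toℕ j) a)
    ≡⟨ ∑-distrib-+ {n} (λ j → δ x a * δ (toℕ j) b) (λ j → δ x b * δ (toℕ j) a) ⟩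
  ∑[ j < n ] (δ x a * δ (toℕ j) b) + ∑[ j < n ] (δ x b * δ (toℕ j) a)
    ≡⟨ cong₂ _+_ (*-distribˡ-sum {n} (δ x a) (λ j → δ (toℕ j) b))
                 (*-distribˡ-sum {n} (δ x b) (λ j → δ (toℕ j) a)) ⟨
  δ x a * (∑[ j < n ] δ (toℕ j) b) + δ x b * (∑[ j < n ] δ (toℕ j) a)
    ≡⟨ cong₂ _+_ (trans (cong (δ x a *_) (∑-δ b b<n)) (*-identityʳ (δ x a)))
                 (trans (cong (δ x b *_) (∑-δ a a<n)) (*-identityʳ (δ x b))) ⟩
  δ x a + δ x b ∎
  where open ≡-Reasoning

addEdge : ∀ {n} (G : Graph n) {a b} → a ≢ b → Graph n
addEdge G {a} {b} a≢b = record
  { adj    = λ i j → adj G i j ∨ isEdge a b (toℕ i) (toℕ j)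
  ; sym    = λ i j → cong₂ _∨_ (Graph.sym G i j) (isEdge-sym a b (toℕ i) (toℕ j))
  ; irrefl = λ i → cong₂ _∨_ (Graph.irrefl G i) (isEdge-irrefl a≢b (toℕ i))
  }

NonAdjacent : ∀ {n} → Graph n → ℕ → ℕ → Set
NonAdjacent G a b = ∀ i j → toℕ i ≡ a → toℕ j ≡ b → adj G i j ≡ false

addEdge-adj : ∀ {n} (G : Graph n) {a b} (a≢b : a ≢ b) {i j} →
              toℕ i ≡ a → toℕ j ≡ b → adj (addEdge G a≢b) i j ≡ true
addEdge-adj G a≢b {i} {j} refl refl = trans (cong (adj G i j ∨_) (isEdge-self (toℕ i) (toℕ j)))
                                             (∨-zeroʳ (adj G i j))
  where
  ≡ᵇ-refl : ∀ x → (x ≡ᵇ x) ≡ true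
  ≡ᵇ-refl x = Equivalence.to T-≡ (≡⇒≡ᵇ x x refl)
  isEdge-self : ∀ a b → isEdge a b a b ≡ true
  isEdge-self a b rewrite ≡ᵇ-refl a | ≡ᵇ-refl b = refl

deg-addEdge : ∀ {n} (G : Graph n) {a b} (a≢b : a ≢ b) → a < n → b < n → NonAdjacent G a b →
              ∀ i → deg (addEdge G a≢b) i ≡ deg G i + δ (toℕ i) a + δ (toℕ i) b
deg-addEdge {n} G {a} {b} a≢b a<n b<n a≁b i = begin
  deg (addEdge G a≢b) i
    ≡⟨ deg-∑ (addEdge G a≢b) i ⟩
  ∑[ j < n ] 𝟙 (adj G i j ∨ isEdge a b (toℕ i) (toℕ j))
    ≡⟨ sum-cong-≗ {n} (λ j → 𝟙-∨ _ _ (new j)) ⟩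
  ∑[ j < n ] (𝟙 (adj G i j) + 𝟙 (isEdge a b (toℕ i) (toℕ j)))
    ≡⟨ ∑-distrib-+ {n} (λ j → 𝟙 (adj G i j)) (λ j → 𝟙 (isEdge a b (toℕ i) (toℕ j))) ⟩
  ∑[ j < n ] 𝟙 (adj G i j) + ∑[ j < n ] 𝟙 (isEdge a b (toℕ i) (toℕ j))
    ≡⟨ cong₂ _+_ (≡.sym (deg-∑ G i)) (∑-isEdge a≢b a<n b<n (toℕ i)) ⟩
  deg G i + (δ (toℕ i) a + δ (toℕ i) b)
    ≡⟨ +-assoc (deg G i) _ _ ⟨
  deg G i + δ (toℕ i) a + δ (toℕ i) b ∎
  where
  open ≡-Reasoning
  new : ∀ j → adj G i j ≡ true → isEdge a b (toℕ i) (toℕ j) ≡ true → ⊥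
  new j i~j e with isEdge⇒Pair a b (toℕ i) (toℕ j) e
  ... | inj₁ (i≡a , j≡b) = case trans (≡.sym (a≁b i j i≡a j≡b)) i~j of λ ()
  ... | inj₂ (i≡b , j≡a) = case trans (≡.sym (a≁b j i j≡a i≡b)) (trans (Graph.sym G j i) i~j) of λ ()

EdgesIn : ∀ {n} → Graph n → (ℕ → ℕ → Set) → Set
EdgesIn G P = ∀ i j → adj G i j ≡ true → P (toℕ i) (toℕ j)

edgesIn⇒nonAdjacent : ∀ {n} (G : Graph n) {P a b} → EdgesIn G P → ¬ P a b → NonAdjacent G a b
edgesIn⇒nonAdjacent G inP ¬Pab i j refl refl with adj G i j in i~j
... | false = refl
... | true  = ⊥-elim (¬Pab (inP i j i~j))

edgesIn-mono : ∀ {n} (G : Graph n) {P Q : ℕ → ℕ → Set} →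
               (∀ x y → P x y → Q x y) → EdgesIn G P → EdgesIn G Q
edgesIn-mono G P⇒Q inP i j i~j = P⇒Q (toℕ i) (toℕ j) (inP i j i~j)

addEdge-edgesIn : ∀ {n} (G : Graph n) {P a b} (a≢b : a ≢ b) →
                  EdgesIn G P → EdgesIn (addEdge G a≢b) (P ∪ Pair a b)
addEdge-edgesIn G {a = a} {b} a≢b inP i j new~ with adj G i j in i~j
... | true  = inj₁ (inP i j i~j)
... | false = inj₂ (isEdge⇒Pair a b (toℕ i) (toℕ j) new~)

record Realization (n : ℕ) (f : ℕ → ℕ) : Set where
  constructor realization
  field
    graph    : Graph n
    realizes : Realizes graph (f ∘ toℕ)
open Realization

emptyGraph : ∀ {n} → Graph n
emptyGraph = record { adj = λ _ _ → false ; sym = λ _ _ → refl ; irrefl = λ _ → refl }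

emptyRealization : ∀ {n} → Realization n (λ _ → 0)
emptyRealization {n} =
  realization emptyGraph λ i → trans (deg-∑ emptyGraph i) (trans (∑-const n 0) (*-zeroʳ n))

isolated⇒nonAdjacent : ∀ {n f} (R : Realization n f) {a b} → f b ≡ 0 → NonAdjacent (graph R) a b
isolated⇒nonAdjacent (realization G real) f_b≡0 i j _ refl = deg≡0⇒¬adj G (trans (real j) f_b≡0)

withEdge : ∀ {n f} (R : Realization n f) {a b} (a≢b : a ≢ b) → a < n → b < n →
           NonAdjacent (graph R) a b → Realization n (λ v → f v + δ v a + δ v b)
withEdge {f = f} (realization G real) {a} {b} a≢b a<n b<n a≁b =
  realization (addEdge G a≢b) λ i → trans (deg-addEdge G a≢b a<n b<n a≁b i)
                              (cong (λ d → d + δ (toℕ i) a + δ (toℕ i) b) (real i))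

recast : ∀ {n f g} → (∀ v → v < n → f v ≡ g v) → Realization n f → Realization n g
recast f≡g (realization G real) = realization G λ i → trans (real i) (f≡g (toℕ i) (toℕ<n i))

attachLeaves : ∀ {n f} (R : Realization n f) {x ℓ} k → x < ℓ → ℓ + k ≤ n →
               (∀ v → ℓ ≤ v → v < ℓ + k → f v ≡ 0) →
               Realization n (λ v → f v + k * δ v x + interval ℓ k v)
attachLeaves {f = f} R zero x<ℓ _ _ =
  recast (λ v _ → ≡.sym (trans (+-identityʳ (f v + 0)) (+-identityʳ (f v)))) R
attachLeaves {n} {f} R {x} {ℓ} (suc k) x<ℓ ℓ+k<n vanish =
  recast grow (withEdge shorter (<⇒≢ x<ℓ+k) (<-trans x<ℓ+k ℓ+k<n′) ℓ+k<n′
                        (isolated⇒nonAdjacent shorter fresh))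
  where
  before : ℕ → ℕ
  before v = f v + k * δ v x + interval ℓ k v
  ℓ+k<n′ : ℓ + k < n
  ℓ+k<n′ = <-≤-trans (+-monoʳ-< ℓ (n<1+n k)) ℓ+k<n
  x<ℓ+k : x < ℓ + k
  x<ℓ+k = ≤-trans x<ℓ (m≤m+n ℓ k)
  vanish′ : ∀ v → ℓ ≤ v → v < ℓ + k → f v ≡ 0
  vanish′ v ℓ≤v v<ℓ+k = vanish v ℓ≤v (<-trans v<ℓ+k (+-monoʳ-< ℓ (n<1+n k)))
  shorter : Realization n before
  shorter = attachLeaves R k x<ℓ (≤-trans (+-monoʳ-≤ ℓ (n≤1+n k)) ℓ+k<n) vanish′
  fresh : before (ℓ + k) ≡ 0
  fresh = cong₂ _+_ (cong₂ _+_ (vanish (ℓ + k) (m≤m+n ℓ k) (+-monoʳ-< ℓ (n<1+n k)))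
                               (trans (cong (k *_) (δ-≢ (>⇒≢ x<ℓ+k))) (*-zeroʳ k)))
                    (interval-outside ℓ k (inj₂ ≤-refl))
  grow : ∀ v → v < n → before v + δ v x + δ v (ℓ + k) ≡ f v + suc k * δ v x + interval ℓ (suc k) v
  grow v _ = rearrange (f v) k (δ v x) (interval ℓ k v) (δ v (ℓ + k))
    where
    rearrange : ∀ a k d r e → a + k * d + r + d + e ≡ a + (d + k * d) + (r + e)
    rearrange = solve-∀

Consecutive : ℕ → ℕ → Set
Consecutive x y = suc x ≡ y ⊎ suc y ≡ x

pathDeg : ℕ → ℕ → ℕ
pathDeg j v = interval 0 j v + interval 1 j v

path : ∀ {n} j → j < n → Σ[ R ∈ Realization n (pathDeg j) ] EdgesIn (graph R) Consecutive
path zero    _     = emptyRealization , λ _ _ ()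
path {n} (suc j) 1+j<n with path j (<-trans (n<1+n j) 1+j<n)
... | R , inR = recast grow R′
              , edgesIn-mono (graph R′) consecutive (addEdge-edgesIn (graph R) {P = Consecutive} j≢1+j inR)
  where
  j≢1+j : j ≢ suc j
  j≢1+j = <⇒≢ (n<1+n j)
  R′ : Realization n (λ v → pathDeg j v + δ v j + δ v (suc j))
  R′ = withEdge R j≢1+j (<-trans (n<1+n j) 1+j<n) 1+j<n
         (isolated⇒nonAdjacent R (cong₂ _+_ (interval-outside 0 j (inj₂ (n≤1+n j)))
                                             (interval-outside 1 j (inj₂ ≤-refl))))
  grow : ∀ v → v < n → pathDeg j v + δ v j + δ v (suc j) ≡ pathDeg (suc j) v
  grow v _ = +-+-comm (interval 0 j v) (interval 1 j v) (δ v j) (δ v (suc j))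
    where
    +-+-comm : ∀ a b d e → a + b + d + e ≡ a + d + (b + e)
    +-+-comm = solve-∀
  consecutive : ∀ x y → (Consecutive ∪ Pair j (suc j)) x y → Consecutive x y
  consecutive x y (inj₁ c)                    = c
  consecutive x y (inj₂ (inj₁ (refl , refl))) = inj₁ refl
  consecutive x y (inj₂ (inj₂ (refl , refl))) = inj₂ refl

cycleDeg : ℕ → ℕ → ℕ
cycleDeg c v = interval 0 c v + interval 0 c v

cycle : ∀ {n c′} → 2 ≤ c′ → c′ < n →
        Σ[ R ∈ Realization n (cycleDeg (suc c′)) ] EdgesIn (graph R) (Consecutive ∪ Pair 0 c′)
cycle {n} {c′} 2≤c′ c′<n =
  recast degrees closed , addEdge-edgesIn (graph (proj₁ open-path)) {P = Consecutive} 0≢c′ (proj₂ open-path)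
  where
  open-path : Σ[ R ∈ Realization n (pathDeg c′) ] EdgesIn (graph R) Consecutive
  open-path = path c′ c′<n
  0≢c′ : 0 ≢ c′
  0≢c′ = <⇒≢ (<-≤-trans (s≤s z≤n) 2≤c′)
  not-consecutive : ¬ Consecutive 0 c′
  not-consecutive (inj₁ 1≡c′) = <⇒≢ 2≤c′ 1≡c′
  not-consecutive (inj₂ ())
  closed : Realization n (λ v → pathDeg c′ v + δ v 0 + δ v c′)
  closed = withEdge (proj₁ open-path) 0≢c′ (≤-<-trans z≤n c′<n) c′<n
             (edgesIn⇒nonAdjacent (graph (proj₁ open-path)) {P = Consecutive} (proj₂ open-path) not-consecutive)
  degrees : ∀ v → v < n → pathDeg c′ v + δ v 0 + δ v c′ ≡ cycleDeg (suc c′) v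
  degrees v _ = trans (rearrange (interval 0 c′ v) (interval 1 c′ v) (δ v 0) (δ v c′))
                      (cong (interval 0 (suc c′) v +_) (≡.sym (sumBelow-suc c′ (λ i → δ v i))))
    where
    rearrange : ∀ r₀ r₁ d₀ d → r₀ + r₁ + d₀ + d ≡ r₀ + d + (d₀ + r₁)
    rearrange = solve-∀

coreDeg : ℕ → ℕ → ℕ
coreDeg c v = cycleDeg c v + 𝟙 (v <ᵇ 4)

chords : ∀ v → δ v 0 + δ v 2 + δ v 1 + δ v 3 ≡ 𝟙 (v <ᵇ 4)
chords 0 = refl
chords 1 = refl
chords 2 = refl
chords 3 = refl
chords (suc (suc (suc (suc v)))) = refl

-- The cycle with chords 0–2 and 1–3: the chords are new edges because EdgesIn
-- records which pairs can already be adjacent.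
core : ∀ {n c} → 4 ≤ c → c ≤ n → Realization n (coreDeg c)
core {n} {suc c′} (s≤s 2<c′) c′<n = recast degrees R₂
  where
  1<c′ : 1 < c′
  1<c′ = <-trans (n<1+n 1) 2<c′
  1<n : 1 < n
  1<n = <-trans 1<c′ c′<n
  2<n : 2 < n
  2<n = <-trans 2<c′ c′<n
  3<n : 3 < n
  3<n = ≤-trans (s≤s 2<c′) c′<n
  P₁ : ℕ → ℕ → Set
  P₁ = Consecutive ∪ Pair 0 c′
  R₀ : Realization n (cycleDeg (suc c′))
  R₀ = proj₁ (cycle 1<c′ c′<n)
  in₀ : EdgesIn (graph R₀) P₁
  in₀ = proj₂ (cycle 1<c′ c′<n)
  not₁ : ¬ P₁ 0 2
  not₁ (inj₁ (inj₁ ()))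
  not₁ (inj₁ (inj₂ ()))
  not₁ (inj₂ (inj₁ (_ , 2≡c′))) = <⇒≢ 2<c′ 2≡c′
  not₁ (inj₂ (inj₂ (0≡c′ , _))) = <⇒≢ (<-trans (s≤s z≤n) 1<c′) 0≡c′
  R₁ : Realization n (λ v → cycleDeg (suc c′) v + δ v 0 + δ v 2)
  R₁ = withEdge R₀ (λ ()) (<-trans (s≤s z≤n) 1<n) 2<n
                  (edgesIn⇒nonAdjacent (graph R₀) {P = P₁} in₀ not₁)
  P₂ : ℕ → ℕ → Set
  P₂ = P₁ ∪ Pair 0 2
  in₁ : EdgesIn (graph R₁) P₂
  in₁ = addEdge-edgesIn (graph R₀) {P = P₁} (λ ()) in₀
  not₂ : ¬ P₂ 1 3
  not₂ (inj₁ (inj₁ (inj₁ ())))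
  not₂ (inj₁ (inj₁ (inj₂ ())))
  not₂ (inj₁ (inj₂ (inj₁ (() , _))))
  not₂ (inj₁ (inj₂ (inj₂ (1≡c′ , _)))) = <⇒≢ 1<c′ 1≡c′
  not₂ (inj₂ (inj₁ (() , _)))
  not₂ (inj₂ (inj₂ (() , _)))
  R₂ : Realization n (λ v → cycleDeg (suc c′) v + δ v 0 + δ v 2 + δ v 1 + δ v 3)
  R₂ = withEdge R₁ (λ ()) 1<n 3<n (edgesIn⇒nonAdjacent (graph R₁) {P = P₂} in₁ not₂)
  degrees : ∀ v → v < n → cycleDeg (suc c′) v + δ v 0 + δ v 2 + δ v 1 + δ v 3 ≡ coreDeg (suc c′) v
  degrees v _ = trans (regroup (cycleDeg (suc c′) v) (δ v 0) (δ v 2) (δ v 1) (δ v 3))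
                      (cong (cycleDeg (suc c′) v +_) (chords v))
    where
    regroup : ∀ a d₀ d₂ d₁ d₃ → a + d₀ + d₂ + d₁ + d₃ ≡ a + (d₀ + d₂ + d₁ + d₃)
    regroup = solve-∀

coreDeg-outside : ∀ {c v} → 4 ≤ c → c ≤ v → coreDeg c v ≡ 0
coreDeg-outside {c} {v} 4≤c c≤v =
  cong₂ _+_ (cong₂ _+_ r≡0 r≡0) (cong 𝟙 (<ᵇ-false (≤-trans 4≤c c≤v)))
  where
  r≡0 : interval 0 c v ≡ 0
  r≡0 = interval-outside 0 c (inj₂ c≤v)

degreesFrom : ℕ → (ℕ → ℕ) → ℕ → ℕ
degreesFrom c q v = if v <ᵇ c then 2 + 𝟙 (v <ᵇ 4) + q v else 1

degreesFrom-hub : ∀ {c v} (q : ℕ → ℕ) → v < c → degreesFrom c q v ≡ 2 + 𝟙 (v <ᵇ 4) + q v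
degreesFrom-hub {v = v} q v<c = cong (λ b → if b then 2 + 𝟙 (v <ᵇ 4) + q v else 1) (<ᵇ-true v<c)

degreesFrom-leaf : ∀ {c v} (q : ℕ → ℕ) → c ≤ v → degreesFrom c q v ≡ 1
degreesFrom-leaf {v = v} q c≤v = cong (λ b → if b then 2 + 𝟙 (v <ᵇ 4) + q v else 1) (<ᵇ-false c≤v)

-- Vertices below c are the hubs of the core; hub y receives its q y pendant
-- vertices in the block starting at c + Σ_{y′ < y} q y′, and the last two
-- vertices K, K + 1 are joined to each other only.
module DisconnectedRealization {n c} (q : ℕ → ℕ) (4≤c : 4 ≤ c) (size : c + sumBelow c q + 2 ≡ n) where

  K : ℕ
  K = c + sumBelow c q

  1+K<n : suc K < n
  1+K<n = subst (suc K <_) size (≤-reflexive (+-comm 2 K))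

  K<n : K < n
  K<n = <-trans (n<1+n K) 1+K<n

  stageDeg : ℕ → ℕ → ℕ
  stageDeg x v = coreDeg c v + sumBelow x (λ y → q y * δ v y) + interval c (sumBelow x q) v

  stageDeg-vanish : ∀ x {v} → x ≤ c → c + sumBelow x q ≤ v → stageDeg x v ≡ 0
  stageDeg-vanish x {v} x≤c ℓ≤v = cong₂ _+_
    (cong₂ _+_ (coreDeg-outside 4≤c c≤v) (sumBelow-δ-outside q (≤-trans x≤c c≤v)))
    (interval-outside c (sumBelow x q) (inj₂ ℓ≤v))
    where
    c≤v : c ≤ v
    c≤v = ≤-trans (m≤m+n c (sumBelow x q)) ℓ≤v

  stage : ∀ x → x ≤ c → Realization n (stageDeg x)
  stage zero    _   = recast (λ v _ → ≡.sym (trans (+-identityʳ _) (+-identityʳ _)))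
                             (core 4≤c (≤-trans (m≤m+n c _) (<⇒≤ K<n)))
  stage (suc x) x<c = recast grow (attachLeaves (stage x (<⇒≤ x<c)) (q x) x<ℓ fits vanish)
    where
    ℓ : ℕ
    ℓ = c + sumBelow x q
    x<ℓ : x < ℓ
    x<ℓ = ≤-trans x<c (m≤m+n c _)
    fits : ℓ + q x ≤ n
    fits = ≤-trans (≤-reflexive (+-assoc c (sumBelow x q) (q x)))
                   (≤-trans (+-monoʳ-≤ c (sumBelow-mono q x<c)) (<⇒≤ K<n))
    vanish : ∀ v → ℓ ≤ v → v < ℓ + q x → stageDeg x v ≡ 0
    vanish v ℓ≤v _ = stageDeg-vanish x (<⇒≤ x<c) ℓ≤v
    grow : ∀ v → v < n → stageDeg x v + q x * δ v x + interval ℓ (q x) v ≡ stageDeg (suc x) v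
    grow v _ = trans (rearrange (coreDeg c v) _ _ _ _)
                     (cong (coreDeg c v + sumBelow (suc x) (λ y → q y * δ v y) +_)
                           (≡.sym (interval-+ c (sumBelow x q) (q x) v)))
      where
      rearrange : ∀ a s r t r′ → a + s + r + t + r′ ≡ a + (s + t) + (r + r′)
      rearrange = solve-∀

  withExtraEdge : Realization n (λ v → stageDeg c v + δ v K + δ v (suc K))
  withExtraEdge = withEdge (stage c ≤-refl) (<⇒≢ (n<1+n K)) K<n 1+K<n
                    (isolated⇒nonAdjacent (stage c ≤-refl) (stageDeg-vanish c ≤-refl (n≤1+n K)))

  tail-interval : ∀ v → interval c (sumBelow c q) v + δ v K + δ v (suc K) ≡ interval c (sumBelow c q + 2) v
  tail-interval v = begin
    interval c (sumBelow c q) v + δ v K + δ v (suc K)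
      ≡⟨ +-assoc (interval c (sumBelow c q) v) _ _ ⟩
    interval c (sumBelow c q) v + (δ v K + δ v (suc K))
      ≡⟨ cong (interval c (sumBelow c q) v +_)
              (cong₂ (λ a b → δ v a + δ v b) (+-identityʳ K) (+-comm K 1)) ⟨
    interval c (sumBelow c q) v + interval K 2 v
      ≡⟨ interval-+ c (sumBelow c q) 2 v ⟨
    interval c (sumBelow c q + 2) v ∎
    where open ≡-Reasoning

  final-degrees : ∀ v → v < n → stageDeg c v + δ v K + δ v (suc K) ≡ degreesFrom c q v
  final-degrees v v<n = begin
    stageDeg c v + δ v K + δ v (suc K)
      ≡⟨ regroup (coreDeg c v + owners) (interval c (sumBelow c q) v) (δ v K) (δ v (suc K)) ⟩
    coreDeg c v + owners + (interval c (sumBelow c q) v + δ v K + δ v (suc K))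
      ≡⟨ cong (coreDeg c v + owners +_) (tail-interval v) ⟩
    coreDeg c v + owners + interval c (sumBelow c q + 2) v
      ≡⟨ evaluate (v <? c) ⟩
    degreesFrom c q v ∎
    where
    open ≡-Reasoning
    owners : ℕ
    owners = sumBelow c (λ y → q y * δ v y)
    regroup : ∀ a r d e → a + r + d + e ≡ a + (r + d + e)
    regroup = solve-∀
    evaluate : Dec (v < c) → coreDeg c v + owners + interval c (sumBelow c q + 2) v ≡ degreesFrom c q v
    evaluate (yes v<c) rewrite degreesFrom-hub q v<c
                             | interval-inside 0 c z≤n v<c
                             | sumBelow-δ-inside q v<c
                             | interval-outside c (sumBelow c q + 2) (inj₁ v<c) = +-identityʳ _
    evaluate (no v≮c) rewrite degreesFrom-leaf q (≮⇒≥ v≮c)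
                            | coreDeg-outside 4≤c (≮⇒≥ v≮c)
                            | sumBelow-δ-outside q (≮⇒≥ v≮c) =
      interval-inside c (sumBelow c q + 2) (≮⇒≥ v≮c) (subst (v <_) (trans (≡.sym size) (+-assoc c _ 2)) v<n)

  realizes-degrees : Realization n (degreesFrom c q)
  realizes-degrees = recast final-degrees withExtraEdge

  disconnected : ¬ Connected (graph realizes-degrees)
  disconnected = leafEdge⇒¬connected H (leaf K<n c≤K) (leaf 1+K<n (≤-trans c≤K (n≤1+n K)))
                   (addEdge-adj (graph (stage c ≤-refl)) (<⇒≢ (n<1+n K))
                                (toℕ-fromℕ< K<n) (toℕ-fromℕ< 1+K<n))
                   (vertex0≢ K<n 0<K) (vertex0≢ 1+K<n (s≤s z≤n))
    where
    H : Graph n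
    H = graph realizes-degrees
    c≤K : c ≤ K
    c≤K = m≤m+n c (sumBelow c q)
    0<K : 0 < K
    0<K = ≤-trans (≤-trans (s≤s z≤n) 4≤c) c≤K
    leaf : ∀ {v} (v<n : v < n) → c ≤ v → deg H (fromℕ< v<n) ≡ 1
    leaf v<n c≤v = trans (realizes realizes-degrees (fromℕ< v<n))
                         (degreesFrom-leaf q (subst (c ≤_) (≡.sym (toℕ-fromℕ< v<n)) c≤v))
    vertex0 : Fin n
    vertex0 = fromℕ< (<-trans 0<K K<n)
    vertex0≢ : ∀ {v} (v<n : v < n) → 0 < v → vertex0 ≢ fromℕ< v<n
    vertex0≢ v<n 0<v 0≡v =
      <⇒≢ 0<v (trans (≡.sym (toℕ-fromℕ< _)) (trans (cong toℕ 0≡v) (toℕ-fromℕ< v<n)))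

disconnected-realization : ∀ {n c} (q : ℕ → ℕ) → 4 ≤ c → c + sumBelow c q + 2 ≡ n →
                           Σ[ R ∈ Realization n (degreesFrom c q) ] ¬ Connected (graph R)
disconnected-realization q 4≤c size = realizes-degrees , disconnected
  where open DisconnectedRealization q 4≤c size

extendByZero : ∀ {n} → (Fin n → ℕ) → ℕ → ℕ
extendByZero {n} D k with k <? n
... | yes k<n = D (fromℕ< k<n)
... | no  _   = 0

extendByZero-fromℕ< : ∀ {n} (D : Fin n → ℕ) {k} (k<n : k < n) → extendByZero D k ≡ D (fromℕ< k<n)
extendByZero-fromℕ< {n} D {k} k<n with k <? n
... | yes _   = refl
... | no  k≮n  = ⊥-elim (k≮n k<n)

extendByZero-toℕ : ∀ {n} (D : Fin n → ℕ) i → extendByZero D (toℕ i) ≡ D i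
extendByZero-toℕ D i = trans (extendByZero-fromℕ< D (toℕ<n i)) (cong D (fromℕ<-toℕ i (toℕ<n i)))

Antitone : ℕ → (ℕ → ℕ) → Set
Antitone n d = ∀ {k l} → k ≤ l → l < n → d l ≤ d k

extendByZero-antitone : ∀ {n} (D : Fin n → ℕ) → NonIncreasing D → Antitone n (extendByZero D)
extendByZero-antitone {n} D noninc {k} {l} k≤l l<n =
  subst₂ _≤_ (≡.sym (extendByZero-fromℕ< D l<n)) (≡.sym (extendByZero-fromℕ< D k<n))
    (noninc (fromℕ< k<n) (fromℕ< l<n)
            (subst₂ _≤_ (≡.sym (toℕ-fromℕ< k<n)) (≡.sym (toℕ-fromℕ< l<n)) k≤l))
  where
  k<n : k < n
  k<n = ≤-<-trans k≤l l<n

nonLeafCount : (ℕ → ℕ) → ℕ → ℕ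
nonLeafCount d zero = 0
nonLeafCount d (suc n) with 2 ≤? d n
... | yes _ = suc n
... | no  _ = nonLeafCount d n

nonLeafCount-≤ : ∀ d n → nonLeafCount d n ≤ n
nonLeafCount-≤ d zero = z≤n
nonLeafCount-≤ d (suc n) with 2 ≤? d n
... | yes _ = ≤-refl
... | no  _ = m≤n⇒m≤1+n (nonLeafCount-≤ d n)

nonLeafCount-high : ∀ d n → Antitone n d → ∀ {k} → k < nonLeafCount d n → 2 ≤ d k
nonLeafCount-high d (suc n) anti {k} k<c with 2 ≤? d n
... | yes 2≤dₙ = ≤-trans 2≤dₙ (anti (≤-pred k<c) ≤-refl)
... | no  _    = nonLeafCount-high d n (λ k≤l l<n → anti k≤l (m<n⇒m<1+n l<n)) k<c

nonLeafCount-low : ∀ d n {k} → nonLeafCount d n ≤ k → k < n → d k ≤ 1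
nonLeafCount-low d (suc n) {k} c≤k k<1+n with 2 ≤? d n
... | yes _   = ⊥-elim (<⇒≱ k<1+n c≤k)
... | no  2≰dₙ with m≤n⇒m<n∨m≡n (≤-pred k<1+n)
...   | inj₁ k<n  = nonLeafCount-low d n c≤k k<n
...   | inj₂ refl = ≤-pred (≰⇒> 2≰dₙ)

sumBelow-degreesFrom : ∀ {c} t (q : ℕ → ℕ) → 4 ≤ c →
                       sumBelow (c + t) (degreesFrom c q) ≡ c * 2 + 4 + sumBelow c q + t
sumBelow-degreesFrom {c} t q 4≤c = begin
  sumBelow (c + t) (degreesFrom c q)
    ≡⟨ sumBelow-+ c t (degreesFrom c q) ⟩
  sumBelow c (degreesFrom c q) + sumBelow t (λ k → degreesFrom c q (c + k))
    ≡⟨ cong₂ _+_ (sumBelow-cong c (λ v → degreesFrom-hub q))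
                 (trans (sumBelow-cong t (λ k _ → degreesFrom-leaf q (m≤m+n c k)))
                        (trans (sumBelow-const t 1) (*-identityʳ t))) ⟩
  sumBelow c (λ v → 2 + 𝟙 (v <ᵇ 4) + q v) + t
    ≡⟨ cong (_+ t) (trans (sumBelow-distrib-+ c _ q)
                          (cong (_+ sumBelow c q) (sumBelow-distrib-+ c (λ _ → 2) _))) ⟩
  sumBelow c (λ _ → 2) + sumBelow c (λ v → 𝟙 (v <ᵇ 4)) + sumBelow c q + t
    ≡⟨ cong (λ x → x + sumBelow c q + t) (cong₂ _+_ (sumBelow-const c 2) first-four) ⟩
  c * 2 + 4 + sumBelow c q + t ∎
  where
  open ≡-Reasoning
  first-four : sumBelow c (λ v → 𝟙 (v <ᵇ 4)) ≡ 4
  first-four = begin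
    sumBelow c (λ v → 𝟙 (v <ᵇ 4))
      ≡⟨ cong (λ x → sumBelow x (λ v → 𝟙 (v <ᵇ 4))) (m+[n∸m]≡n 4≤c) ⟨
    sumBelow (4 + (c ∸ 4)) (λ v → 𝟙 (v <ᵇ 4))
      ≡⟨ sumBelow-+ 4 (c ∸ 4) (λ v → 𝟙 (v <ᵇ 4)) ⟩
    4 + sumBelow (c ∸ 4) (λ _ → 0)
      ≡⟨ cong (4 +_) (trans (sumBelow-const (c ∸ 4) 0) (*-zeroʳ (c ∸ 4))) ⟩
    4 ∎

degreesFrom-size : ∀ {n c} (q : ℕ → ℕ) → 4 ≤ c → c ≤ n →
                   sumBelow n (degreesFrom c q) ≡ n + 1 + (n + 1) → c + sumBelow c q + 2 ≡ n
degreesFrom-size {n} {c} q 4≤c c≤n total = begin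
  c + sumBelow c q + 2    ≡⟨ +-assoc c (sumBelow c q) 2 ⟩
  c + (sumBelow c q + 2)  ≡⟨ cong (c +_) (trans (+-comm (sumBelow c q) 2) (≡.sym t≡2+s)) ⟩
  c + t                   ≡⟨ m+[n∸m]≡n c≤n ⟩
  n                       ∎
  where
  open ≡-Reasoning
  t s : ℕ
  t = n ∸ c
  s = sumBelow c q
  lhs : ∀ c t → c + t + 1 + (c + t + 1) ≡ c * 2 + t + (2 + t)
  lhs = solve-∀
  rhs : ∀ c t s → c * 2 + 4 + s + t ≡ c * 2 + t + (2 + (2 + s))
  rhs = solve-∀
  total′ : c * 2 + t + (2 + t) ≡ c * 2 + t + (2 + (2 + s))
  total′ = begin
    c * 2 + t + (2 + t)                 ≡⟨ lhs c t ⟨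
    c + t + 1 + (c + t + 1)             ≡⟨ cong (λ x → x + 1 + (x + 1)) (m+[n∸m]≡n c≤n) ⟩
    n + 1 + (n + 1)                     ≡⟨ total ⟨
    sumBelow n (degreesFrom c q)        ≡⟨ cong (λ x → sumBelow x (degreesFrom c q)) (m+[n∸m]≡n c≤n) ⟨
    sumBelow (c + t) (degreesFrom c q)  ≡⟨ sumBelow-degreesFrom t q 4≤c ⟩
    c * 2 + 4 + s + t                   ≡⟨ rhs c t s ⟩
    c * 2 + t + (2 + (2 + s))           ∎
  t≡2+s : t ≡ 2 + s
  t≡2+s = +-cancelˡ-≡ 2 t (2 + s) (+-cancelˡ-≡ (c * 2 + t) (2 + t) (2 + (2 + s)) total′)

-- Only evaluated at hubs, where d v ≥ 2 + [v < 4], so the subtraction does not truncate.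
excess : (ℕ → ℕ) → ℕ → ℕ
excess d v = d v ∸ (2 + 𝟙 (v <ᵇ 4))

4≤nonLeafCount : ∀ d n → 3 < n → 3 ≤ d 3 → 4 ≤ nonLeafCount d n
4≤nonLeafCount d n 3<n 3≤d₃ =
  ≮⇒≥ λ c<4 → <⇒≱ (s≤s (s≤s z≤n)) (≤-trans 3≤d₃ (nonLeafCount-low d n (≤-pred c<4) 3<n))

degreesFrom-nonLeafCount : ∀ d n → Antitone n d → (∀ k → k < n → 0 < d k) → 3 < n → 3 ≤ d 3 →
                           ∀ v → v < n → degreesFrom (nonLeafCount d n) (excess d) v ≡ d v
degreesFrom-nonLeafCount d n anti positive 3<n 3≤d₃ v v<n with v <? nonLeafCount d n
... | yes v<c = trans (degreesFrom-hub (excess d) v<c) (m+[n∸m]≡n (hub-bound (v <? 4)))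
  where
  hub-bound : Dec (v < 4) → 2 + 𝟙 (v <ᵇ 4) ≤ d v
  hub-bound (yes v<4) rewrite <ᵇ-true v<4      = ≤-trans 3≤d₃ (anti (≤-pred v<4) 3<n)
  hub-bound (no  v≮4) rewrite <ᵇ-false (≮⇒≥ v≮4) = nonLeafCount-high d n anti v<c
... | no  v≮c = trans (degreesFrom-leaf (excess d) (≮⇒≥ v≮c))
                      (≤-antisym (positive v v<n) (nonLeafCount-low d n (≮⇒≥ v≮c) v<n))

d₄≥3⇒disconnected : ∀ {m} (D : Fin (4 + m) → ℕ) → NonIncreasing D → (∀ i → 0 < D i) →
                    sum D ≡ 4 + m + 1 + (4 + m + 1) → 3 ≤ D (suc (suc (suc zero))) →
                    Σ[ H ∈ Graph (4 + m) ] Realizes H D × ¬ Connected H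
d₄≥3⇒disconnected {m} D noninc positive sumD 3≤d₄ =
  let R , disconnected = disconnected-realization (excess d) 4≤c size
  in  graph R
    , (λ i → trans (realizes R i) (trans (agree (toℕ i) (toℕ<n i)) (extendByZero-toℕ D i)))
    , disconnected
  where
  n : ℕ
  n = 4 + m
  d : ℕ → ℕ
  d = extendByZero D
  c : ℕ
  c = nonLeafCount d n
  3<n : 3 < n
  3<n = s≤s (s≤s (s≤s (s≤s z≤n)))
  3≤d₃ : 3 ≤ d 3
  3≤d₃ = subst (3 ≤_) (≡.sym (extendByZero-toℕ D (suc (suc (suc zero))))) 3≤d₄
  4≤c : 4 ≤ c
  4≤c = 4≤nonLeafCount d n 3<n 3≤d₃
  agree : ∀ v → v < n → degreesFrom c (excess d) v ≡ d v
  agree = degreesFrom-nonLeafCount d n (extendByZero-antitone D noninc)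
            (λ k k<n → subst (0 <_) (≡.sym (extendByZero-fromℕ< D k<n)) (positive _)) 3<n 3≤d₃
  size : c + sumBelow c (excess d) + 2 ≡ n
  size = degreesFrom-size (excess d) 4≤c (nonLeafCount-≤ d n) (begin
    sumBelow n (degreesFrom c (excess d)) ≡⟨ sumBelow-cong n agree ⟩
    sumBelow n d                          ≡⟨ ∑-toℕ n d ⟨
    ∑[ i < n ] d (toℕ i)                  ≡⟨ sum-cong-≗ (extendByZero-toℕ D) ⟩
    sum D                                 ≡⟨ sumD ⟩
    n + 1 + (n + 1)                       ∎)
    where open ≡-Reasoning

d₄≤1⇒edges≤n : ∀ {m} (D : Fin (4 + m) → ℕ) (G : Graph (4 + m)) → NonIncreasing D → Realizes G D →
               Connected G → D (suc (suc (suc zero))) ≤ 1 → edges G ≤ 4 + m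
d₄≤1⇒edges≤n D G noninc realizes-G connected d₄≤1 = edges≤-threeHubs G connected leaf
  where
  leaf : ∀ l → deg G (3 ↑ʳ l) ≡ 1
  leaf l = ≤-antisym (≤-trans (≤-reflexive (realizes-G (3 ↑ʳ l)))
                              (≤-trans (noninc (suc (suc (suc zero))) (3 ↑ʳ l) (s≤s (s≤s (s≤s z≤n)))) d₄≤1))
                     (connected⇒0<deg G connected (3 ↑ʳ l))

lemma4p10 : (m : ℕ) (D : Fin (7 + m) → ℕ) → NonIncreasing D → ForciblyBicyclic D
            → D (suc (suc (suc zero))) ≡ 2
lemma4p10 m D noninc ((G , realizes-G) , forced) = ≤-antisym (≮⇒≥ not-above) (≮⇒≥ not-below)
  where
  connected : Connected G
  connected = proj₁ (forced G realizes-G)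
  edges≡ : edges G ≡ 7 + m + 1
  edges≡ = proj₂ (forced G realizes-G)
  not-below : ¬ D (suc (suc (suc zero))) < 2
  not-below d₄<2 = <⇒≱ (m<m+n (7 + m) (s≤s z≤n))
    (subst (_≤ 7 + m) edges≡ (d₄≤1⇒edges≤n D G noninc realizes-G connected (≤-pred d₄<2)))
  not-above : ¬ 2 < D (suc (suc (suc zero)))
  not-above d₄>2 =
    let H , realizes-H , disconnected = d₄≥3⇒disconnected D noninc positive sumD d₄>2
    in  disconnected (proj₁ (forced H realizes-H))
    where
    positive : ∀ i → 0 < D i
    positive i = subst (0 <_) (realizes-G i) (connected⇒0<deg G connected i)
    sumD : sum D ≡ 7 + m + 1 + (7 + m + 1)
    sumD = trans (sum-cong-≗ (λ i → ≡.sym (realizes-G i)))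
                 (trans (handshake G) (cong₂ _+_ edges≡ edges≡))
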